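{- Let $\mathcal{T}=(T,\mathsf{bag})$ be a regular and strongly $(q,k)$-unbreakable tree decomposition of a graph $G$. Let $x\in V(T)$ and $S\subseteq \mathsf{cone}(x)$ be such that $|S|\leq k$. Then for any $u,v\in \mathsf{bag}(x)\setminus S$: (1) $u$ and $v$ are connected in $G[\mathsf{cone}(x)]-S$ if and only if they are connected in $\mathsf{bgraph}_S(x)$; (2) if $u$ and $v$ are disconnected in $\mathsf{bgraph}_S(x)$, and $C_u,C_v$ are the connected components of $\mathsf{bgraph}_S(x)$ containing $u$ and $v$ respectively, then $|V(C_u)|\leq q$ or $|V(C_v)|\leq q$.
   Context: A tree decomposition $\mathcal T=(T,\mathsf{bag})$ of $G$ consists of a rooted tree $T$ and $\mathsf{bag}:V(T)\to 2^{V(G)}$ such that for each vertex $u$ the nodes whose bags contain $u$ induce a nonempty connected subtree, and each edge of $G$ lies in some bag. For a node $x$ with parent $p$ ($\mathsf{bag}(p)=\emptyset$ if $x$ is the root): $\mathsf{adh}(x)=\mathsf{bag}(p)\cap\mathsf{bag}(x)$; $\mathsf{mrg}(x)=\mathsf{bag}(x)\setminus\mathsf{adh}(x)$; $\mathsf{cone}(x)$ is the union of the bags of all descendants of $x$ (including $x$); $\mathsf{comp}(x)=\mathsf{cone}(x)\setminus\mathsf{adh}(x)$. $\mathcal T$ is regular if for every non-root $x$: $\mathsf{mrg}(x)\neq\emptyset$, $G[\mathsf{comp}(x)]$ is connected, and every vertex of $\mathsf{adh}(x)$ has a neighbor in $\mathsf{comp}(x)$. A separation of a graph $H$ is a pair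 $(A,B)$ with $A\cup B=V(H)$ and no edge between $A\setminus B$ and $B\setminus A$; its order is $|A\cap B|$. A set $X$ is $(q,k)$-unbreakable in $H$ if for every separation $(A,B)$ of $H$ of order at most $k$, $|A\cap X|\le q$ or $|B\cap X|\le q$. $\mathcal T$ is strongly $(q,k)$-unbreakable if every $\mathsf{bag}(x)$ is $(q,k)$-unbreakable in $G[\mathsf{cone}(x)]$. The bag graph $\mathsf{bgraph}(x)$ has vertex set the disjoint union of $\mathsf{bag}(x)$ and the children of $x$; $u,v\in\mathsf{bag}(x)$ adjacent iff adjacent in $G$; $u\in\mathsf{bag}(x)$ and child $y$ adjacent iff $u$ has a neighbor in $\mathsf{comp}(y)$; children pairwise non-adjacent. For $S\subseteq\mathsf{cone}(x)$, $\mathsf{bgraph}_S(x)$ is obtained from $\mathsf{bgraph}(x)$ by removing every vertex of $S\cap\mathsf{bag}(x)$, and for every child $y$ of $x$, removing $y$ and adding, for each pair $\{u,v\}\subseteq\mathsf{adh}(y)\setminus S$, the edge $uv$ (if not already present) whenever $G[\mathsf{cone}(y)]$ contains a $u$-$v$ path disjoint from $S$. -}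

module Defs where

open import Data.Nat using (ℕ; _≤_)
open import Data.Bool using (Bool; T)
open import Data.Fin using (Fin)
open import Data.Fin.Subset using (Subset; _∈_; _∉_; ∣_∣; _∩_; ⊥)
open import Data.Maybe using (Maybe; just; nothing)
open import Data.Product using (Σ; ∃; _×_; _,_)
open import Data.Sum using (_⊎_)
open import Relation.Nullary using (¬_)
open import Relation.Binary.PropositionalEquality using (_≡_)
open import Relation.Binary.Construct.Closure.ReflexiveTransitive using (Star)

record Graph (n : ℕ) : Set where
  field
    adj    : Fin n → Fin n → Bool
    sym    : ∀ u v → T (adj u v) → T (adj v u)
    irrefl : ∀ u → ¬ T (adj u u)

Edge : ∀ {n} → Graph n → Fin n → Fin n → Set
Edge G u v = T (Graph.adj G u v)

EdgeIn : ∀ {n} → Graph n → (Fin n → Set) → Fin n → Fin n → Set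
EdgeIn G W u v = W u × W v × Edge G u v

-- u and v are connected in the induced subgraph G[W] (u, v ∈ W assumed
-- separately; a walk of length zero connects u to itself).
ConnectedIn : ∀ {n} → Graph n → (Fin n → Set) → Fin n → Fin n → Set
ConnectedIn G W u v = Star (EdgeIn G W) u v

-- |P| ≤ q for a set P ⊆ Fin n given as a predicate:
-- every (finite, decidable) subset of P has at most q elements.
AtMost : ∀ {n} → ℕ → (Fin n → Set) → Set
AtMost {n} q P = (C : Subset n) → (∀ w → w ∈ C → P w) → ∣ C ∣ ≤ q

ParentOf : ∀ {m} → (Fin m → Maybe (Fin m)) → Fin m → Fin m → Set
ParentOf parent x p = parent x ≡ just p

record RootedTree (m : ℕ) : Set where
  field
    root        : Fin m
    parent      : Fin m → Maybe (Fin m)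
    root-parent : parent root ≡ nothing
    -- every node reaches the root by following parents (so no cycles)
    reach       : ∀ x → Star (ParentOf parent) x root

  _isParentOf_ : Fin m → Fin m → Set
  p isParentOf x = ParentOf parent x p

  TreeAdj : Fin m → Fin m → Set
  TreeAdj a b = ParentOf parent a b ⊎ ParentOf parent b a

  Descendant : Fin m → Fin m → Set
  Descendant y x = Star (ParentOf parent) y x

record TreeDecomposition {n : ℕ} (G : Graph n) : Set where
  field
    m    : ℕ
    tree : RootedTree m
    bag  : Fin m → Subset n
  open RootedTree tree public
  field
    vertex-nonempty  : ∀ u → ∃ λ t → u ∈ bag t
    vertex-connected : ∀ u t t' → u ∈ bag t → u ∈ bag t' →
                       Star (λ a b → u ∈ bag a × u ∈ bag b × TreeAdj a b) t t'
    edge-covered     : ∀ u v → Edge G u v → ∃ λ t → u ∈ bag t × v ∈ bag t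

module _ {n : ℕ} {G : Graph n} (𝒯 : TreeDecomposition G) where
  open TreeDecomposition 𝒯

  adh : Fin m → Subset n
  adh x with parent x
  ... | just p  = bag p ∩ bag x
  ... | nothing = ⊥

  InMrg : Fin m → Fin n → Set
  InMrg x u = u ∈ bag x × u ∉ adh x

  InCone : Fin m → Fin n → Set
  InCone x u = ∃ λ y → Descendant y x × u ∈ bag y

  InComp : Fin m → Fin n → Set
  InComp x u = InCone x u × u ∉ adh x

  Regular : Set
  Regular = ∀ x p → p isParentOf x →
      (∃ λ u → InMrg x u)
    × (∀ u v → InComp x u → InComp x v → ConnectedIn G (InComp x) u v)
    × (∀ u → u ∈ adh x → ∃ λ w → InComp x w × Edge G u w)

  IsSeparation : Fin m → Subset n → Subset n → Set
  IsSeparation x A B =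
      (∀ u → u ∈ A → InCone x u)
    × (∀ u → u ∈ B → InCone x u)
    × (∀ u → InCone x u → u ∈ A ⊎ u ∈ B)
    × (∀ a b → a ∈ A → a ∉ B → b ∈ B → b ∉ A → ¬ Edge G a b)

  UnbreakableInCone : ℕ → ℕ → Fin m → Subset n → Set
  UnbreakableInCone q k x X =
    ∀ A B → IsSeparation x A B → ∣ A ∩ B ∣ ≤ k →
      ∣ A ∩ X ∣ ≤ q ⊎ ∣ B ∩ X ∣ ≤ q

  StronglyUnbreakable : ℕ → ℕ → Set
  StronglyUnbreakable q k = ∀ x → UnbreakableInCone q k x (bag x)

  InConeMinus : Fin m → Subset n → Fin n → Set
  InConeMinus x S u = InCone x u × u ∉ S

  InBagMinus : Fin m → Subset n → Fin n → Set
  InBagMinus x S u = u ∈ bag x × u ∉ S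

  BgEdgeS : Fin m → Subset n → Fin n → Fin n → Set
  BgEdgeS x S u v =
      Edge G u v
    ⊎ (∃ λ y → x isParentOf y × u ∈ adh y × v ∈ adh y
               × ConnectedIn G (InConeMinus y S) u v)

  BgConnected : Fin m → Subset n → Fin n → Fin n → Set
  BgConnected x S = Star (λ a b → InBagMinus x S a × InBagMinus x S b × BgEdgeS x S a b)

-- A walk of G[cone(x)] - S between vertices of bag(x) splits at its visits to bag(x); each
-- detour in between stays inside comp(y) for a single child y, enters and leaves through
-- adh(y), and is therefore replaced by one edge of bgraph_S(x). This gives (1). For (2), the
-- vertices reachable from u in G[cone(x)] - S, together with S, and the rest of cone(x),
-- together with S, form a separation of G[cone(x)] of order at most |S| ≤ k. By (1) it puts
-- the component of u in bgraph_S(x) on one side and that of v on the other, so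
-- unbreakability of bag(x) bounds one of them by q.
module Submission where

open import Defs
open import Level using (Level)
open import Data.Nat using (ℕ; _≤_)
import Data.Nat.Properties as ℕ
open import Data.Fin using (Fin; _≟_)
open import Data.Fin.Properties using (any?)
open import Data.Fin.Subset using (Subset; _∈_; _∉_; _⊆_; _⊂_; _⊃_; ∣_∣; _∩_; _∪_; ⁅_⁆)
open import Data.Fin.Subset.Properties
  using (_∈?_; x∈p∩q⁺; x∈p∩q⁻; x∈p∪q⁺; x∈p∪q⁻; p⊆p∪q; x∈⁅x⁆; x∈⁅y⁆⇒x≡y; p⊆q⇒∣p∣≤∣q∣)
open import Data.Fin.Subset.Induction using (Acc; acc; ⊃-wellFounded)
open import Data.Maybe using (just)
open import Data.Maybe.Properties using (just-injective; ≡-dec)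
open import Data.Product using (∃; _×_; _,_; proj₁; proj₂)
open import Data.Sum using (_⊎_; inj₁; inj₂)
import Data.Sum as Sum
open import Data.Vec using (tabulate)
open import Data.Vec.Properties using (lookup∘tabulate; lookup⇒[]=; []=⇒lookup)
open import Function using (_∘_; id)
open import Relation.Nullary using (¬_; Dec; yes; no; does; contradiction)
open import Relation.Nullary.Decidable using (_×-dec_; _⊎-dec_; ¬?; map′; dec-true; decidable-stable; T?)
open import Relation.Unary using (Pred)
import Relation.Unary as U
open import Relation.Binary using (Rel)
import Relation.Binary as B
open import Relation.Binary.PropositionalEquality using (refl; sym; trans; subst)
open import Relation.Binary.Construct.Closure.ReflexiveTransitive
  using (Star; ε; _◅_; _◅◅_; gmap; reverse)

module _ {N : ℕ} {ℓ : Level} {P : Pred (Fin N) ℓ} (P? : U.Decidable P) where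

  toSubset : Subset N
  toSubset = tabulate (does ∘ P?)

  ∈-toSubset⁺ : ∀ {w} → P w → w ∈ toSubset
  ∈-toSubset⁺ {w} p = lookup⇒[]= w _ (trans (lookup∘tabulate _ w) (dec-true (P? w) p))

  ∈-toSubset⁻ : ∀ {w} → w ∈ toSubset → P w
  ∈-toSubset⁻ {w} h with P? w | trans (sym (lookup∘tabulate (does ∘ P?) w)) ([]=⇒lookup h)
  ... | yes p | _  = p
  ... | no _  | ()

AtMost-⊆ : ∀ {n} {P : Fin n → Set} {X : Subset n} {q : ℕ} →
           (∀ w → P w → w ∈ X) → ∣ X ∣ ≤ q → AtMost q P
AtMost-⊆ P⊆X ∣X∣≤q C C⊆P = ℕ.≤-trans (p⊆q⇒∣p∣≤∣q∣ (λ {w} w∈C → P⊆X w (C⊆P w w∈C))) ∣X∣≤q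

module _ {N : ℕ} {ℓ : Level} {E : Rel (Fin N) ℓ} (E? : B.Decidable E) where

  Star-closed : (R : Subset N) → (∀ {a b} → a ∈ R → E a b → b ∈ R) →
                ∀ {a w} → a ∈ R → Star E a w → w ∈ R
  Star-closed R closed a∈R ε       = a∈R
  Star-closed R closed a∈R (e ◅ p) = Star-closed R closed (closed a∈R e) p

  -- Grow a set R of vertices reachable from u by the head of an edge leaving R, until R is
  -- closed; this terminates because R strictly increases.
  private
    saturate : ∀ {u} (R : Subset N) → Acc _⊃_ R → (∀ w → w ∈ R → Star E u w) → u ∈ R →
               ∀ w → Dec (Star E u w)
    saturate {u} R (acc rec) R-reached u∈R
      with any? (λ b → any? (λ a → a ∈? R ×-dec E? a b) ×-dec ¬? (b ∈? R))
    ... | no ¬exit = λ w → map′ (R-reached w) (Star-closed R closed u∈R) (w ∈? R)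
      where
      closed : ∀ {a b} → a ∈ R → E a b → b ∈ R
      closed {a} {b} a∈R e = decidable-stable (b ∈? R) (λ b∉R → ¬exit (b , (a , a∈R , e) , b∉R))
    ... | yes (b , (a , a∈R , e) , b∉R) =
      saturate (R ∪ ⁅ b ⁆) (rec R⊂R∪b) R∪b-reached (p⊆p∪q ⁅ b ⁆ u∈R)
      where
      R⊂R∪b : R ⊂ R ∪ ⁅ b ⁆
      R⊂R∪b = p⊆p∪q ⁅ b ⁆ , b , x∈p∪q⁺ (inj₂ (x∈⁅x⁆ b)) , b∉R
      R∪b-reached : ∀ w → w ∈ R ∪ ⁅ b ⁆ → Star E u w
      R∪b-reached w h with x∈p∪q⁻ R ⁅ b ⁆ h
      ... | inj₁ w∈R = R-reached w w∈R
      ... | inj₂ w∈b rewrite x∈⁅y⁆⇒x≡y b w∈b = R-reached a a∈R ◅◅ (e ◅ ε)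

  Star? : B.Decidable (Star E)
  Star? u = saturate ⁅ u ⁆ (⊃-wellFounded _)
    (λ w w∈u → subst (Star E u) (sym (x∈⁅y⁆⇒x≡y u w∈u)) ε) (x∈⁅x⁆ u)

module Cones {n : ℕ} {G : Graph n} (𝒯 : TreeDecomposition G) where
  open TreeDecomposition 𝒯

  ∈-adh⁻ : ∀ {p y w} → p isParentOf y → w ∈ adh 𝒯 y → w ∈ bag p × w ∈ bag y
  ∈-adh⁻ {p} {y} e h with parent y
  ∈-adh⁻ {p} {y} refl h | just .p = x∈p∩q⁻ (bag p) (bag y) h

  ∈-adh⁺ : ∀ {p y w} → p isParentOf y → w ∈ bag p → w ∈ bag y → w ∈ adh 𝒯 y
  ∈-adh⁺ {p} {y} e w∈p w∈y with parent y
  ∈-adh⁺ {p} {y} refl w∈p w∈y | just .p = x∈p∩q⁺ (w∈p , w∈y)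

  parent-not-descendant : ∀ {c z} → c isParentOf z → ¬ Descendant c z
  parent-not-descendant {z = z} = go (reach z)
    where
    go : ∀ {z} → Descendant z root → ∀ {c} → c isParentOf z → ¬ Descendant c z
    go ε c↑root _ with trans (sym c↑root) root-parent
    ... | ()
    go (c′↑z ◅ r) c↑z c⇝z with just-injective (trans (sym c↑z) c′↑z)
    go (c′↑z ◅ r) c↑z ε          | refl = go r c′↑z ε
    go (c′↑z ◅ r) c↑z (d↑c ◅ d⇝z) | refl = go r d↑c (d⇝z ◅◅ (c′↑z ◅ ε))

  -- By connectivity of the bags containing w, a bag-walk of w leaving the subtree of y
  -- crosses the edge from y to its parent.
  descendant-or-∈adh : ∀ {w y d t} → Descendant d y →
    Star (λ a b → w ∈ bag a × w ∈ bag b × TreeAdj a b) d t → Descendant t y ⊎ w ∈ adh 𝒯 y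
  descendant-or-∈adh d⇝y ε = inj₁ d⇝y
  descendant-or-∈adh ε ((w∈a , w∈b , inj₁ b↑a) ◅ _) = inj₂ (∈-adh⁺ b↑a w∈b w∈a)
  descendant-or-∈adh (c↑d ◅ c⇝y) ((_ , _ , inj₁ b↑d) ◅ rest) with just-injective (trans (sym c↑d) b↑d)
  ... | refl = descendant-or-∈adh c⇝y rest
  descendant-or-∈adh d⇝y ((_ , _ , inj₂ a↑b) ◅ rest) = descendant-or-∈adh (a↑b ◅ d⇝y) rest

  comp-bag⇒descendant : ∀ {y w t} → InComp 𝒯 y w → w ∈ bag t → Descendant t y
  comp-bag⇒descendant {w = w} {t} ((d , d⇝y , w∈d) , w∉adh) w∈t
    with descendant-or-∈adh d⇝y (vertex-connected w d t w∈d w∈t)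
  ... | inj₁ t⇝y  = t⇝y
  ... | inj₂ w∈adh = contradiction w∈adh w∉adh

  comp-edge⇒cone : ∀ {y w z} → InComp 𝒯 y w → Edge G w z → InCone 𝒯 y z
  comp-edge⇒cone {w = w} {z} w∈comp e with edge-covered w z e
  ... | t , w∈t , z∈t = t , comp-bag⇒descendant w∈comp w∈t , z∈t

  bag⊆cone : ∀ {x w} → w ∈ bag x → InCone 𝒯 x w
  bag⊆cone w∈x = _ , ε , w∈x

  cone-child⊆cone : ∀ {x y w} → x isParentOf y → InCone 𝒯 y w → InCone 𝒯 x w
  cone-child⊆cone x↑y (d , d⇝y , w∈d) = d , d⇝y ◅◅ (x↑y ◅ ε) , w∈d

  below-child : ∀ {d c x} → c isParentOf d → Descendant c x → ∃ λ y → x isParentOf y × Descendant d y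
  below-child {d} c↑d ε = d , c↑d , ε
  below-child c↑d (e↑c ◅ e⇝x) with below-child e↑c e⇝x
  ... | y , x↑y , c⇝y = y , x↑y , c↑d ◅ c⇝y

  cone∖bag⊆comp-child : ∀ {x w} → InCone 𝒯 x w → w ∉ bag x → ∃ λ y → x isParentOf y × InComp 𝒯 y w
  cone∖bag⊆comp-child (d , ε , w∈d) w∉x = contradiction w∈d w∉x
  cone∖bag⊆comp-child (d , c↑d ◅ c⇝x , w∈d) w∉x with below-child c↑d c⇝x
  ... | y , x↑y , d⇝y = y , x↑y , (d , d⇝y , w∈d) , w∉x ∘ proj₁ ∘ ∈-adh⁻ x↑y

  cone-child∩bag⊆adh : ∀ {x y a} → x isParentOf y → InCone 𝒯 y a → a ∈ bag x → a ∈ adh 𝒯 y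
  cone-child∩bag⊆adh {x} {y} {a} x↑y (d , d⇝y , a∈d) a∈x
    with descendant-or-∈adh d⇝y (vertex-connected a d x a∈d a∈x)
  ... | inj₁ x⇝y   = contradiction x⇝y (parent-not-descendant x↑y)
  ... | inj₂ a∈adh = a∈adh

  InCone? : ∀ x → U.Decidable (InCone 𝒯 x)
  InCone? x w = any? (λ y → Star? (λ a b → ≡-dec _≟_ (parent a) (just b)) y x ×-dec (w ∈? bag y))

module BagGraph {n : ℕ} {G : Graph n} (𝒯 : TreeDecomposition G)
                (x : Fin (TreeDecomposition.m 𝒯)) (S : Subset n) where
  open TreeDecomposition 𝒯
  open Cones 𝒯

  private
    W : Fin n → Set
    W = InConeMinus 𝒯 x S

    _~_ : Fin n → Fin n → Set
    _~_ = BgConnected 𝒯 x S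

  bgConnected⇒connected : ∀ {a b} → a ~ b → ConnectedIn G W a b
  bgConnected⇒connected ε = ε
  bgConnected⇒connected (((a∈x , a∉S) , (b∈x , b∉S) , inj₁ e) ◅ r) =
    ((bag⊆cone a∈x , a∉S) , (bag⊆cone b∈x , b∉S) , e) ◅ bgConnected⇒connected r
  bgConnected⇒connected ((_ , _ , inj₂ (y , x↑y , _ , _ , path)) ◅ r) =
    gmap id lift path ◅◅ bgConnected⇒connected r
    where
    lift : ∀ {a b} → EdgeIn G (InConeMinus 𝒯 y S) a b → EdgeIn G W a b
    lift ((a∈y , a∉S) , (b∈y , b∉S) , e) = (cone-child⊆cone x↑y a∈y , a∉S) , (cone-child⊆cone x↑y b∈y , b∉S) , e

  ExitsThrough : Fin m → Fin n → Fin n → Set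
  ExitsThrough y a v = ∃ λ b → b ∈ adh 𝒯 y × b ∉ S × ConnectedIn G (InConeMinus 𝒯 y S) a b × b ~ v

  -- Read backwards from v: a vertex of the walk in bag(x) is bgraph-connected to v, and a
  -- vertex in comp(y) reaches inside cone(y) - S the vertex of adh(y) where the walk leaves comp(y).
  walk⇒bgConnected : ∀ {a v} → v ∈ bag x → a ∉ S → ConnectedIn G W a v →
    (a ∈ bag x → a ~ v) × (∀ y → x isParentOf y → InComp 𝒯 y a → ExitsThrough y a v)
  walk⇒bgConnected v∈x _ ε =
    (λ _ → ε) , λ y x↑y (v∈y , v∉adh) → contradiction (cone-child∩bag⊆adh x↑y v∈y v∈x) v∉adh
  walk⇒bgConnected {a} {v} v∈x a∉S (_◅_ {j = b} (_ , (b∈cone , b∉S) , e) r)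
    with walk⇒bgConnected v∈x b∉S r
  ... | from-bag , from-comp = from-bag′ , from-comp′
    where
    edge-in-cone : ∀ {y} → InComp 𝒯 y a → EdgeIn G (InConeMinus 𝒯 y S) a b
    edge-in-cone a∈comp = (proj₁ a∈comp , a∉S) , (comp-edge⇒cone a∈comp e , b∉S) , e

    from-bag′ : a ∈ bag x → a ~ v
    from-bag′ a∈x with b ∈? bag x
    ... | yes b∈x = ((a∈x , a∉S) , (b∈x , b∉S) , inj₁ e) ◅ from-bag b∈x
    ... | no b∉x with cone∖bag⊆comp-child b∈cone b∉x
    ... | y , x↑y , b∈comp with from-comp y x↑y b∈comp
    ... | c , c∈adh , c∉S , b⇝c , c~v = ((a∈x , a∉S) , (proj₁ (∈-adh⁻ x↑y c∈adh) , c∉S) , bg-edge) ◅ c~v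
      where
      a∈cone : InCone 𝒯 y a
      a∈cone = comp-edge⇒cone b∈comp (Graph.sym G _ _ e)
      bg-edge : BgEdgeS 𝒯 x S a c
      bg-edge = inj₂ (y , x↑y , cone-child∩bag⊆adh x↑y a∈cone a∈x , c∈adh ,
                      ((a∈cone , a∉S) , (proj₁ b∈comp , b∉S) , e) ◅ b⇝c)

    from-comp′ : ∀ y → x isParentOf y → InComp 𝒯 y a → ExitsThrough y a v
    from-comp′ y x↑y a∈comp with b ∈? adh 𝒯 y
    ... | yes b∈adh = b , b∈adh , b∉S , edge-in-cone a∈comp ◅ ε , from-bag (proj₁ (∈-adh⁻ x↑y b∈adh))
    ... | no b∉adh with from-comp y x↑y (comp-edge⇒cone a∈comp e , b∉adh)
    ... | c , c∈adh , c∉S , b⇝c , c~v = c , c∈adh , c∉S , edge-in-cone a∈comp ◅ b⇝c , c~v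

  connected⇒bgConnected : ∀ {u v} → u ∈ bag x → u ∉ S → v ∈ bag x → ConnectedIn G W u v → u ~ v
  connected⇒bgConnected u∈x u∉S v∈x u⇝v = proj₁ (walk⇒bgConnected v∈x u∉S u⇝v) u∈x

  bgConnected-∈bag : ∀ {u w} → InBagMinus 𝒯 x S u → u ~ w → w ∈ bag x
  bgConnected-∈bag (u∈x , _) ε = u∈x
  bgConnected-∈bag _ ((_ , b∈x∖S , _) ◅ r) = bgConnected-∈bag b∈x∖S r

  connected-∈cone : ∀ {a w} → InCone 𝒯 x a → ConnectedIn G W a w → InCone 𝒯 x w
  connected-∈cone a∈cone ε = a∈cone
  connected-∈cone _ ((_ , (b∈cone , _) , _) ◅ r) = connected-∈cone b∈cone r

  module ReachSeparation (S⊆cone : ∀ w → w ∈ S → InCone 𝒯 x w) {u : Fin n} (u∈x : u ∈ bag x) where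

    Reached : Fin n → Set
    Reached = ConnectedIn G W u

    Reached? : U.Decidable Reached
    Reached? = Star? (λ a b → W? a ×-dec (W? b ×-dec T? (Graph.adj G a b))) u
      where
      W? : U.Decidable W
      W? w = InCone? x w ×-dec ¬? (w ∈? S)

    InA InB : Fin n → Set
    InA w = w ∈ S ⊎ Reached w
    InB w = InCone 𝒯 x w × (w ∈ S ⊎ ¬ Reached w)

    InA? : U.Decidable InA
    InA? w = w ∈? S ⊎-dec Reached? w

    InB? : U.Decidable InB
    InB? w = InCone? x w ×-dec (w ∈? S ⊎-dec ¬? (Reached? w))

    A B : Subset n
    A = toSubset InA?
    B = toSubset InB?

    ∈A⁺ : ∀ {w} → InA w → w ∈ A
    ∈A⁺ = ∈-toSubset⁺ InA?

    ∈A⁻ : ∀ {w} → w ∈ A → InA w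
    ∈A⁻ = ∈-toSubset⁻ InA?

    ∈B⁺ : ∀ {w} → InB w → w ∈ B
    ∈B⁺ = ∈-toSubset⁺ InB?

    ∈B⁻ : ∀ {w} → w ∈ B → InB w
    ∈B⁻ = ∈-toSubset⁻ InB?

    isSeparation : IsSeparation 𝒯 x A B
    isSeparation = A⊆cone , (λ _ → proj₁ ∘ ∈B⁻) , cover , no-edge
      where
      A⊆cone : ∀ w → w ∈ A → InCone 𝒯 x w
      A⊆cone w = Sum.[ S⊆cone w , connected-∈cone (bag⊆cone u∈x) ] ∘ ∈A⁻
      cover : ∀ w → InCone 𝒯 x w → w ∈ A ⊎ w ∈ B
      cover w w∈cone with InA? w
      ... | yes w∈A = inj₁ (∈A⁺ w∈A)
      ... | no w∉A  = inj₂ (∈B⁺ (w∈cone , inj₂ (w∉A ∘ inj₂)))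
      no-edge : ∀ a b → a ∈ A → a ∉ B → b ∈ B → b ∉ A → ¬ Edge G a b
      no-edge a b a∈A a∉B b∈B b∉A e = b∉A (∈A⁺ (inj₂ (u⇝a ◅◅ ((a∈W , b∈W , e) ◅ ε))))
        where
        a∉S : a ∉ S
        a∉S a∈S = a∉B (∈B⁺ (S⊆cone a a∈S , inj₁ a∈S))
        u⇝a : Reached a
        u⇝a = Sum.[ (λ a∈S → contradiction a∈S a∉S) , id ] (∈A⁻ a∈A)
        a∈W : W a
        a∈W = connected-∈cone (bag⊆cone u∈x) u⇝a , a∉S
        b∈W : W b
        b∈W = proj₁ (∈B⁻ b∈B) , b∉A ∘ ∈A⁺ ∘ inj₁

    A∩B⊆S : A ∩ B ⊆ S
    A∩B⊆S {w} h with x∈p∩q⁻ A B h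
    ... | w∈A , w∈B with ∈A⁻ w∈A | proj₂ (∈B⁻ w∈B)
    ... | inj₁ w∈S | _        = w∈S
    ... | inj₂ _   | inj₁ w∈S = w∈S
    ... | inj₂ u⇝w | inj₂ u⇏w = contradiction u⇝w u⇏w

    component-⊆A : u ∉ S → ∀ w → u ~ w → w ∈ A ∩ bag x
    component-⊆A u∉S w u~w =
      x∈p∩q⁺ (∈A⁺ (inj₂ (bgConnected⇒connected u~w)) , bgConnected-∈bag (u∈x , u∉S) u~w)

    component-⊆B : ∀ {v} → u ∉ S → v ∈ bag x → v ∉ S → ¬ u ~ v → ∀ w → v ~ w → w ∈ B ∩ bag x
    component-⊆B u∉S v∈x v∉S u≁v w v~w = x∈p∩q⁺ (∈B⁺ (bag⊆cone w∈x , inj₂ u⇏w) , w∈x)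
      where
      w∈x : w ∈ bag x
      w∈x = bgConnected-∈bag (v∈x , v∉S) v~w
      flip-edge : ∀ {a b} → EdgeIn G W a b → EdgeIn G W b a
      flip-edge (a∈W , b∈W , e) = b∈W , a∈W , Graph.sym G _ _ e
      u⇏w : ¬ Reached w
      u⇏w u⇝w = u≁v (connected⇒bgConnected u∈x u∉S v∈x
                       (u⇝w ◅◅ reverse flip-edge (bgConnected⇒connected v~w)))

lemma3p6 : ∀ {n} (G : Graph n) (𝒯 : TreeDecomposition G) (q k : ℕ) →
    Regular 𝒯 → StronglyUnbreakable 𝒯 q k →
    ∀ (x : Fin (TreeDecomposition.m 𝒯)) (S : Subset n) →
    (∀ u → u ∈ S → InCone 𝒯 x u) → ∣ S ∣ ≤ k →
    ∀ u v → u ∈ TreeDecomposition.bag 𝒯 x → u ∉ S →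
            v ∈ TreeDecomposition.bag 𝒯 x → v ∉ S →
      ((ConnectedIn G (InConeMinus 𝒯 x S) u v → BgConnected 𝒯 x S u v)
        × (BgConnected 𝒯 x S u v → ConnectedIn G (InConeMinus 𝒯 x S) u v))
    × (¬ BgConnected 𝒯 x S u v →
         AtMost q (BgConnected 𝒯 x S u) ⊎ AtMost q (BgConnected 𝒯 x S v))
lemma3p6 G 𝒯 q k _ unbreakable x S S⊆cone ∣S∣≤k u v u∈x u∉S v∈x v∉S =
    (connected⇒bgConnected u∈x u∉S v∈x , bgConnected⇒connected)
  , λ u≁v → Sum.map (AtMost-⊆ (component-⊆A u∉S))
                    (AtMost-⊆ (component-⊆B u∉S v∈x v∉S u≁v))
                    (unbreakable x A B isSeparation (ℕ.≤-trans (p⊆q⇒∣p∣≤∣q∣ A∩B⊆S) ∣S∣≤k))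
  where
  open BagGraph 𝒯 x S
  open ReachSeparation S⊆cone u∈x
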